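{- Let $D=(V,\mathcal{B})$ be a symmetric $(v,k,\lambda)$ design and let $\alpha$ be an automorphism of $D$ of prime order $p$ with $\lambda<p$. Then $$|F(\alpha)|+\sum_{B\in F_b(\alpha)}|B\setminus F(\alpha)|\leq v.$$
   Context: A symmetric $(v,k,\lambda)$ design, for integers $v>k>\lambda\geq 0$, is a pair $D=(V,\mathcal{B})$ where $V$ is a set of $v$ points and $\mathcal{B}$ is a set of $k$-subsets of $V$ (blocks) such that $|\mathcal{B}|=v$, every point lies in exactly $k$ blocks, any two distinct blocks meet in exactly $\lambda$ points, and any two distinct points lie in exactly $\lambda$ common blocks. An automorphism of $D$ is a permutation of $V$ mapping blocks to blocks. For an automorphism $\alpha$, $F(\alpha)$ denotes the set of points fixed by $\alpha$ and $F_b(\alpha)$ the set of blocks $B$ with $B^{\alpha}=B$. -}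

module Defs where

open import Data.Nat using (ℕ; zero; suc; _+_; _<_)
open import Data.Bool using (Bool; true; false)
open import Data.Fin using (Fin)
open import Data.Fin.Subset using (Subset; _∈_; _∩_; _─_; ∣_∣)
open import Data.Fin.Permutation using (Permutation′; _⟨$⟩ʳ_; _⟨$⟩ˡ_)
open import Data.Vec using (tabulate)
open import Data.Product using (_×_; Σ; ∃)
open import Relation.Binary.PropositionalEquality using (_≡_; _≢_)
open import Relation.Nullary using (Dec; yes; no; does)
open import Data.Fin.Properties using (_≟_)
open import Data.Vec.Properties using ()
open import Data.Fin.Subset.Properties using (_∈?_)

-- A design on the point set Fin v with v blocks, indexed by Fin v
-- (block j is the subset B j of the points).
Blocks : ℕ → Set
Blocks v = Fin v → Subset v

-- number of blocks containing both points x and y (x = y gives replication number)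
blocksThrough : ∀ {v} → Blocks v → Fin v → Fin v → ℕ
blocksThrough {v} B x y = ∣ tabulate (λ j → does (x ∈? B j) Data.Bool.∧ does (y ∈? B j)) ∣
  where import Data.Bool

record IsSymmetricDesign (v k lam : ℕ) (B : Blocks v) : Set where
  field
    k<v        : k < v
    lam<k      : lam < k
    blockSize  : ∀ j → ∣ B j ∣ ≡ k
    pointDeg   : ∀ x → blocksThrough B x x ≡ k
    blockMeet  : ∀ i j → i ≢ j → ∣ B i ∩ B j ∣ ≡ lam
    pointPairs : ∀ x y → x ≢ y → blocksThrough B x y ≡ lam

image : ∀ {v} → Permutation′ v → Subset v → Subset v
image α S = tabulate (λ x → does ((α ⟨$⟩ˡ x) ∈? S))

IsAutomorphism : ∀ {v} → Blocks v → Permutation′ v → Set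
IsAutomorphism B α = ∀ j → ∃ λ j′ → image α (B j) ≡ B j′

iter : ∀ {v} → Permutation′ v → ℕ → Fin v → Fin v
iter α zero    x = x
iter α (suc n) x = α ⟨$⟩ʳ (iter α n x)

HasOrder : ∀ {v} → Permutation′ v → ℕ → Set
HasOrder α n = (0 < n) × (∀ x → iter α n x ≡ x)
             × (∀ m → 0 < m → m < n → ∃ λ x → iter α m x ≢ x)

fixedPoints : ∀ {v} → Permutation′ v → Subset v
fixedPoints α = tabulate (λ x → does ((α ⟨$⟩ʳ x) ≟ x))

sumFin : ∀ {n} → (Fin n → ℕ) → ℕ
sumFin {zero}  f = 0
sumFin {suc n} f = f Fin.zero + sumFin (λ i → f (Fin.suc i))
  where import Data.Fin as Fin

isFixedBlock : ∀ {v} → Blocks v → Permutation′ v → Fin v → Bool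
isFixedBlock {v} B α j = does (decEqSubset (image α (B j)) (B j))
  where
  open import Data.Vec.Properties using (≡-dec)
  import Data.Bool.Properties as BP
  decEqSubset : (S T : Subset v) → Dec (S ≡ T)
  decEqSubset = ≡-dec BP._≟_

fixedBlockSum : ∀ {v} → Blocks v → Permutation′ v → ℕ
fixedBlockSum B α = sumFin (λ j → if isFixedBlock B α j then ∣ B j ─ fixedPoints α ∣ else 0)
  where open import Data.Bool using (if_then_else_)

module Submission where

-- The proof is a disjointness argument:
-- the sets  F  and  B ∖ F  for the α-fixed blocks B are pairwise disjoint subsets of
-- the v points, so their sizes add up to at most v.
--
-- The only real content is that a point
-- x moved by α lies in at most one α-fixed block: since p is prime, the α-orbit of x has
-- exactly p elements, and an α-fixed block containing x contains this whole orbit; two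
-- distinct fixed blocks through x would thus meet in at least p > λ points.

open import Defs
open import Data.Nat using (ℕ; _+_; _≤_; _<_)
open import Data.Nat.Primality using (Prime)
open import Data.Fin.Subset using (∣_∣)
open import Data.Fin.Permutation using (Permutation′)

open import Data.Nat using (zero; suc; _*_; _∸_; z≤n; >-nonZero)
open import Data.Nat.Properties
  using (+-suc; +-identityʳ; ≤-<-trans; <⇒≤; <⇒≱; <-cmp; m+[n∸m]≡n; m<n⇒0<n∸m; m∸n≤m;
         module ≤-Reasoning)
open import Data.Nat.GCD using (module Bézout)
open import Data.Nat.Coprimality using (prime⇒coprime; coprime-Bézout)
open import Data.Bool using (true; false; T; if_then_else_)
import Data.Bool.Properties as Bool
open import Data.Unit using (tt)
open import Data.Fin using (Fin; toℕ) renaming (zero to fzero; suc to fsuc)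
open import Data.Fin.Properties using (toℕ-injective; toℕ<n; suc-injective; 0≢1+n; _≟_)
open import Data.Fin.Subset using (Subset; _∈_; _∉_; _∩_; _∪_; _─_; _-_; ⊥; Empty; inside; outside)
open import Data.Fin.Subset.Properties
  using (_∈?_; ∉⊥; ∣⊥∣≡0; ∣p∣≤n; Empty-unique; x∈p∩q⁺; x∈p∩q⁻; x∈p∪q⁻; p─q⊆p;
         x∈p∧x≢y⇒x∈p-y; x∈p⇒∣p-x∣<∣p∣)
open import Data.Fin.Permutation using (_⟨$⟩ʳ_; _⟨$⟩ˡ_; inverseˡ)
open import Data.Vec using ([]; _∷_; tabulate; here; there)
open import Data.Vec.Properties using (lookup∘tabulate; lookup⇒[]=; ≡-dec)
open import Data.Product using (_×_; _,_; ∃)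
open import Data.Sum using (inj₁; inj₂)
open import Function.Definitions using (Injective)
open import Relation.Nullary using (Dec; yes; no; does; contradiction)
open import Relation.Nullary.Decidable using (dec-true; toWitness; isYes≗does)
open import Relation.Binary.Definitions using (tri<; tri≈; tri>)
open import Relation.Binary.PropositionalEquality
  using (_≡_; _≢_; refl; sym; trans; cong; cong₂; subst; module ≡-Reasoning)

sumFin-cong : ∀ {n} {f g : Fin n → ℕ} → (∀ i → f i ≡ g i) → sumFin f ≡ sumFin g
sumFin-cong {zero}  f≗g = refl
sumFin-cong {suc n} f≗g = cong₂ _+_ (f≗g fzero) (sumFin-cong (λ i → f≗g (fsuc i)))

∈-tabulate⁺ : ∀ {n} {P : Fin n → Set} (P? : ∀ y → Dec (P y)) {x} →
              P x → x ∈ tabulate (λ y → does (P? y))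
∈-tabulate⁺ P? {x} px = lookup⇒[]= x _ (trans (lookup∘tabulate _ x) (dec-true (P? x) px))

x∈p─q⇒x∉q : ∀ {n} (p q : Subset n) {x} → x ∈ p ─ q → x ∉ q
x∈p─q⇒x∉q (inside ∷ p) (outside ∷ q) here ()
x∈p─q⇒x∉q (_ ∷ p) (_ ∷ q) (there x∈p─q) (there x∈q) = x∈p─q⇒x∉q p q x∈p─q x∈q

∣p∪q∣+∣p∩q∣≡∣p∣+∣q∣ : ∀ {n} (p q : Subset n) → ∣ p ∪ q ∣ + ∣ p ∩ q ∣ ≡ ∣ p ∣ + ∣ q ∣
∣p∪q∣+∣p∩q∣≡∣p∣+∣q∣ [] [] = refl
∣p∪q∣+∣p∩q∣≡∣p∣+∣q∣ (inside ∷ p) (inside ∷ q) =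
  cong suc (trans (+-suc ∣ p ∪ q ∣ ∣ p ∩ q ∣)
                  (trans (cong suc (∣p∪q∣+∣p∩q∣≡∣p∣+∣q∣ p q)) (sym (+-suc ∣ p ∣ ∣ q ∣))))
∣p∪q∣+∣p∩q∣≡∣p∣+∣q∣ (inside ∷ p) (outside ∷ q) = cong suc (∣p∪q∣+∣p∩q∣≡∣p∣+∣q∣ p q)
∣p∪q∣+∣p∩q∣≡∣p∣+∣q∣ (outside ∷ p) (inside ∷ q) =
  trans (cong suc (∣p∪q∣+∣p∩q∣≡∣p∣+∣q∣ p q)) (sym (+-suc ∣ p ∣ ∣ q ∣))
∣p∪q∣+∣p∩q∣≡∣p∣+∣q∣ (outside ∷ p) (outside ∷ q) = ∣p∪q∣+∣p∩q∣≡∣p∣+∣q∣ p q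

disjoint⇒∣p∪q∣≡∣p∣+∣q∣ : ∀ {n} (p q : Subset n) → Empty (p ∩ q) → ∣ p ∪ q ∣ ≡ ∣ p ∣ + ∣ q ∣
disjoint⇒∣p∪q∣≡∣p∣+∣q∣ {n} p q p∩q-empty = begin
  ∣ p ∪ q ∣              ≡⟨ sym (+-identityʳ ∣ p ∪ q ∣) ⟩
  ∣ p ∪ q ∣ + 0          ≡⟨ cong (∣ p ∪ q ∣ +_) (sym ∣p∩q∣≡0) ⟩
  ∣ p ∪ q ∣ + ∣ p ∩ q ∣  ≡⟨ ∣p∪q∣+∣p∩q∣≡∣p∣+∣q∣ p q ⟩
  ∣ p ∣ + ∣ q ∣          ∎
  where
  open ≡-Reasoning
  ∣p∩q∣≡0 : ∣ p ∩ q ∣ ≡ 0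
  ∣p∩q∣≡0 = trans (cong ∣_∣ (Empty-unique p∩q-empty)) (∣⊥∣≡0 n)

⋃ᶠ : ∀ {m n} → (Fin m → Subset n) → Subset n
⋃ᶠ {zero}  S = ⊥
⋃ᶠ {suc m} S = S fzero ∪ ⋃ᶠ (λ i → S (fsuc i))

∈⋃ᶠ⁻ : ∀ {m n} (S : Fin m → Subset n) {x} → x ∈ ⋃ᶠ S → ∃ λ i → x ∈ S i
∈⋃ᶠ⁻ {zero}  S x∈⋃ = contradiction x∈⋃ ∉⊥
∈⋃ᶠ⁻ {suc m} S x∈⋃ with x∈p∪q⁻ (S fzero) (⋃ᶠ (λ i → S (fsuc i))) x∈⋃
... | inj₁ x∈S₀   = fzero , x∈S₀
... | inj₂ x∈rest with ∈⋃ᶠ⁻ (λ i → S (fsuc i)) x∈rest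
...   | i , x∈Sᵢ = fsuc i , x∈Sᵢ

PairwiseDisjoint : ∀ {m n} → (Fin m → Subset n) → Set
PairwiseDisjoint S = ∀ {i j x} → x ∈ S i → x ∈ S j → i ≡ j

disjoint⇒sum≡∣⋃ᶠ∣ : ∀ {m n} (S : Fin m → Subset n) → PairwiseDisjoint S →
                    sumFin (λ i → ∣ S i ∣) ≡ ∣ ⋃ᶠ S ∣
disjoint⇒sum≡∣⋃ᶠ∣ {zero} {n} S _ = sym (∣⊥∣≡0 n)
disjoint⇒sum≡∣⋃ᶠ∣ {suc m} S disj = begin
  ∣ S fzero ∣ + sumFin (λ i → ∣ rest i ∣)  ≡⟨ cong (∣ S fzero ∣ +_) (disjoint⇒sum≡∣⋃ᶠ∣ rest rest-disj) ⟩
  ∣ S fzero ∣ + ∣ ⋃ᶠ rest ∣                 ≡⟨ sym (disjoint⇒∣p∪q∣≡∣p∣+∣q∣ (S fzero) (⋃ᶠ rest) head-disj) ⟩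
  ∣ ⋃ᶠ S ∣                                  ∎
  where
  open ≡-Reasoning
  rest : Fin m → Subset _
  rest i = S (fsuc i)
  rest-disj : PairwiseDisjoint rest
  rest-disj x∈i x∈j = suc-injective (disj x∈i x∈j)
  head-disj : Empty (S fzero ∩ ⋃ᶠ rest)
  head-disj (x , x∈∩) with x∈p∩q⁻ (S fzero) (⋃ᶠ rest) x∈∩
  ... | x∈S₀ , x∈⋃ with ∈⋃ᶠ⁻ rest x∈⋃
  ... | i , x∈Sᵢ = 0≢1+n (disj x∈S₀ x∈Sᵢ)

disjoint⇒sum≤n : ∀ {m n} (S : Fin m → Subset n) → PairwiseDisjoint S →
                 sumFin (λ i → ∣ S i ∣) ≤ n
disjoint⇒sum≤n S disj = subst (_≤ _) (sym (disjoint⇒sum≡∣⋃ᶠ∣ S disj)) (∣p∣≤n (⋃ᶠ S))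

-- m distinct points of S show m ≤ |S|: remove the image of 0 and recurse.
injective⇒≤∣S∣ : ∀ {m n} (S : Subset n) (f : Fin m → Fin n) →
                 Injective _≡_ _≡_ f → (∀ i → f i ∈ S) → m ≤ ∣ S ∣
injective⇒≤∣S∣ {zero}  S f _   _   = z≤n
injective⇒≤∣S∣ {suc m} S f inj f∈S =
  ≤-<-trans (injective⇒≤∣S∣ (S - f fzero) (λ i → f (fsuc i)) tail-inj tail∈)
            (x∈p⇒∣p-x∣<∣p∣ (f∈S fzero))
  where
  tail-inj : Injective _≡_ _≡_ (λ i → f (fsuc i))
  tail-inj eq = suc-injective (inj eq)
  tail∈ : ∀ i → f (fsuc i) ∈ S - f fzero
  tail∈ i = x∈p∧x≢y⇒x∈p-y (f∈S (fsuc i)) (λ eq → 0≢1+n (sym (inj eq)))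

module Powers {v : ℕ} (α : Permutation′ v) where

  iter-+ : ∀ m n x → iter α (m + n) x ≡ iter α m (iter α n x)
  iter-+ zero    n x = refl
  iter-+ (suc m) n x = cong (α ⟨$⟩ʳ_) (iter-+ m n x)

  iter-injective : ∀ n → Injective _≡_ _≡_ (iter α n)
  iter-injective zero    eq = eq
  iter-injective (suc n) {x} {y} eq = iter-injective n (begin
    iter α n x                          ≡⟨ sym (inverseˡ α) ⟩
    α ⟨$⟩ˡ (α ⟨$⟩ʳ iter α n x)          ≡⟨ cong (α ⟨$⟩ˡ_) eq ⟩
    α ⟨$⟩ˡ (α ⟨$⟩ʳ iter α n y)          ≡⟨ inverseˡ α ⟩
    iter α n y                          ∎)
    where open ≡-Reasoning

  iter-* : ∀ q m {x} → iter α m x ≡ x → iter α (q * m) x ≡ x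
  iter-* zero    m     fixed = refl
  iter-* (suc q) m {x} fixed =
    trans (iter-+ m (q * m) x) (trans (cong (iter α m) (iter-* q m fixed)) fixed)

  equal-powers : ∀ {a b x} → a ≤ b → iter α a x ≡ iter α b x → iter α (b ∸ a) x ≡ x
  equal-powers {a} {b} {x} a≤b eq = iter-injective a (begin
    iter α a (iter α (b ∸ a) x)  ≡⟨ sym (iter-+ a (b ∸ a) x) ⟩
    iter α (a + (b ∸ a)) x       ≡⟨ cong (λ n → iter α n x) (m+[n∸m]≡n a≤b) ⟩
    iter α b x                   ≡⟨ sym eq ⟩
    iter α a x                   ∎)
    where open ≡-Reasoning

  -- If α^p x = x with p prime, then α^d x = x for some 0 < d < p already forces αx = x:
  -- by Bézout, 1 is an integer combination of p and d.
  prime-period : ∀ {p d x} → Prime p → iter α p x ≡ x → 0 < d → d < p →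
                 iter α d x ≡ x → α ⟨$⟩ʳ x ≡ x
  prime-period {p} {d} {x} p-prime αᵖx≡x 0<d d<p αᵈx≡x
    with coprime-Bézout (prime⇒coprime p-prime {{>-nonZero 0<d}} d<p)
  ... | Bézout.+- a b 1+bd≡ap = begin
    α ⟨$⟩ʳ x               ≡⟨ cong (α ⟨$⟩ʳ_) (sym (iter-* b d αᵈx≡x)) ⟩
    iter α (1 + b * d) x   ≡⟨ cong (λ n → iter α n x) 1+bd≡ap ⟩
    iter α (a * p) x       ≡⟨ iter-* a p αᵖx≡x ⟩
    x                      ∎
    where open ≡-Reasoning
  ... | Bézout.-+ a b 1+ap≡bd = begin
    α ⟨$⟩ʳ x               ≡⟨ cong (α ⟨$⟩ʳ_) (sym (iter-* a p αᵖx≡x)) ⟩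
    iter α (1 + a * p) x   ≡⟨ cong (λ n → iter α n x) 1+ap≡bd ⟩
    iter α (b * d) x       ≡⟨ iter-* b d αᵈx≡x ⟩
    x                      ∎
    where open ≡-Reasoning

  orbit-distinct : ∀ {p a b x} → Prime p → iter α p x ≡ x → α ⟨$⟩ʳ x ≢ x →
                   a < b → b < p → iter α a x ≢ iter α b x
  orbit-distinct {a = a} {b = b} p-prime αᵖx≡x moved a<b b<p αᵃx≡αᵇx =
    moved (prime-period p-prime αᵖx≡x (m<n⇒0<n∸m a<b) (≤-<-trans (m∸n≤m b a) b<p)
                        (equal-powers (<⇒≤ a<b) αᵃx≡αᵇx))

  orbit-injective : ∀ {p x} → Prime p → iter α p x ≡ x → α ⟨$⟩ʳ x ≢ x →
                    Injective _≡_ _≡_ (λ (i : Fin p) → iter α (toℕ i) x)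
  orbit-injective p-prime αᵖx≡x moved {i} {j} eq with <-cmp (toℕ i) (toℕ j)
  ... | tri< i<j _ _ = contradiction eq (orbit-distinct p-prime αᵖx≡x moved i<j (toℕ<n j))
  ... | tri≈ _ i≡j _ = toℕ-injective i≡j
  ... | tri> _ _ j<i = contradiction (sym eq) (orbit-distinct p-prime αᵖx≡x moved j<i (toℕ<n i))

  image-closed : ∀ {S} → image α S ≡ S → ∀ {y} → y ∈ S → α ⟨$⟩ʳ y ∈ S
  image-closed {S} αS≡S {y} y∈S =
    subst (α ⟨$⟩ʳ y ∈_) αS≡S
          (∈-tabulate⁺ (λ z → (α ⟨$⟩ˡ z) ∈? S) (subst (_∈ S) (sym (inverseˡ α)) y∈S))

  iter-closed : ∀ {S} → image α S ≡ S → ∀ {y} → y ∈ S → ∀ n → iter α n y ∈ S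
  iter-closed αS≡S y∈S zero    = y∈S
  iter-closed αS≡S y∈S (suc n) = image-closed αS≡S (iter-closed αS≡S y∈S n)

  fixed⇒∈F : ∀ {x} → α ⟨$⟩ʳ x ≡ x → x ∈ fixedPoints α
  fixed⇒∈F = ∈-tabulate⁺ (λ y → (α ⟨$⟩ʳ y) ≟ y)

-- A symmetric design with λ < p and a permutation α with α^p = id, p prime.
module FixedBlocks {v k lam p : ℕ} {B : Blocks v} (D : IsSymmetricDesign v k lam B)
                   (α : Permutation′ v) (p-prime : Prime p)
                   (αᵖ≡id : ∀ x → iter α p x ≡ x) (lam<p : lam < p) where
  open IsSymmetricDesign D using (blockMeet)
  open Powers α

  F : Subset v
  F = fixedPoints α

  -- A moved point lies in at most one α-invariant block: two distinct ones would both
  -- contain its orbit of p points, yet meet in only λ < p points.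
  moved⇒unique-invariant-block : ∀ {i j x} → α ⟨$⟩ʳ x ≢ x →
    image α (B i) ≡ B i → image α (B j) ≡ B j → x ∈ B i → x ∈ B j → i ≡ j
  moved⇒unique-invariant-block {i} {j} {x} moved αBᵢ≡Bᵢ αBⱼ≡Bⱼ x∈Bᵢ x∈Bⱼ with i ≟ j
  ... | yes i≡j = i≡j
  ... | no  i≢j = contradiction p≤λ (<⇒≱ lam<p)
    where
    orbit⊆Bᵢ∩Bⱼ : ∀ (t : Fin p) → iter α (toℕ t) x ∈ B i ∩ B j
    orbit⊆Bᵢ∩Bⱼ t = x∈p∩q⁺ (iter-closed αBᵢ≡Bᵢ x∈Bᵢ (toℕ t) , iter-closed αBⱼ≡Bⱼ x∈Bⱼ (toℕ t))
    p≤λ : p ≤ lam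
    p≤λ = subst (p ≤_) (blockMeet i j i≢j)
                (injective⇒≤∣S∣ (B i ∩ B j) (λ t → iter α (toℕ t) x)
                                (orbit-injective p-prime (αᵖ≡id x) moved) orbit⊆Bᵢ∩Bⱼ)

  movedPart : Fin v → Subset v
  movedPart j = if isFixedBlock B α j then B j ─ F else ⊥

  ∣movedPart∣ : ∀ j → ∣ movedPart j ∣ ≡ (if isFixedBlock B α j then ∣ B j ─ F ∣ else 0)
  ∣movedPart∣ j with isFixedBlock B α j
  ... | true  = refl
  ... | false = ∣⊥∣≡0 v

  ∈movedPart⁻ : ∀ j {x} → x ∈ movedPart j →
                image α (B j) ≡ B j × x ∈ B j × x ∉ F
  ∈movedPart⁻ j x∈part with isFixedBlock B α j in fixed
  ... | false = contradiction x∈part ∉⊥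
  ... | true  = invariant , p─q⊆p (B j) F x∈part , x∈p─q⇒x∉q (B j) F x∈part
    where
    invariant : image α (B j) ≡ B j
    invariant = toWitness (subst T (sym (trans (isYes≗does invariant?) fixed)) tt)
      where
      invariant? : Dec (image α (B j) ≡ B j)
      invariant? = ≡-dec Bool._≟_ (image α (B j)) (B j)

  parts : Fin (suc v) → Subset v
  parts fzero    = F
  parts (fsuc j) = movedPart j

  parts-disjoint : PairwiseDisjoint parts
  parts-disjoint {fzero}  {fzero}  _    _    = refl
  parts-disjoint {fzero}  {fsuc j} x∈F  x∈Mⱼ with ∈movedPart⁻ j x∈Mⱼ
  ... | _ , _ , x∉F = contradiction x∈F x∉F
  parts-disjoint {fsuc i} {fzero}  x∈Mᵢ x∈F  with ∈movedPart⁻ i x∈Mᵢ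
  ... | _ , _ , x∉F = contradiction x∈F x∉F
  parts-disjoint {fsuc i} {fsuc j} x∈Mᵢ x∈Mⱼ
    with ∈movedPart⁻ i x∈Mᵢ | ∈movedPart⁻ j x∈Mⱼ
  ... | αBᵢ≡Bᵢ , x∈Bᵢ , x∉F | αBⱼ≡Bⱼ , x∈Bⱼ , _ =
    cong fsuc (moved⇒unique-invariant-block (λ αx≡x → x∉F (fixed⇒∈F αx≡x))
                                            αBᵢ≡Bᵢ αBⱼ≡Bⱼ x∈Bᵢ x∈Bⱼ)

  parts-size : sumFin (λ i → ∣ parts i ∣) ≡ ∣ F ∣ + fixedBlockSum B α
  parts-size = cong (∣ F ∣ +_) (sumFin-cong ∣movedPart∣)

lemma2p5 : (v k lam p : ℕ) (B : Blocks v) → IsSymmetricDesign v k lam B →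
    (α : Permutation′ v) → IsAutomorphism B α → Prime p → HasOrder α p → lam < p →
    ∣ fixedPoints α ∣ + fixedBlockSum B α ≤ v
lemma2p5 v k lam p B D α _ p-prime (_ , αᵖ≡id , _) lam<p = begin
  ∣ fixedPoints α ∣ + fixedBlockSum B α  ≡⟨ sym parts-size ⟩
  sumFin (λ i → ∣ parts i ∣)             ≤⟨ disjoint⇒sum≤n parts parts-disjoint ⟩
  v                                      ∎
  where
  open ≤-Reasoning
  open FixedBlocks D α p-prime αᵖ≡id lam<p
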